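{- Let $n,m$ be positive integers. Then $$A(K_n\uplus \overline{K}_m;x)=A(K_n;x)\,\widetilde{A}_m(x)+m\,x^m,\qquad\text{where}\quad \widetilde{A}_m(x)=\sum_{r=0}^{m}\binom{m}{r}x^{\min\{2r,\,m+1\}}.$$
   Context: All graphs are finite and simple with at least one vertex. $K_n$ is the complete graph on $n$ vertices and $\overline{K}_m$ its complement (the edgeless graph on $m$ vertices). The join $\Gamma_1\uplus\Gamma_2$ of two graphs with disjoint vertex sets is their disjoint union together with all edges joining a vertex of $\Gamma_1$ to a vertex of $\Gamma_2$. For a graph $\Gamma=(V,E)$ of order $n$, a vertex $v$ and $X\subseteq V$, $\delta_X(v)$ is the number of neighbours of $v$ in $X$, $\delta_1$ the maximum degree, $\bar S=V\setminus S$, and $\mathcal{K}=[-\delta_1,\delta_1]\cap\mathbb{Z}$. A nonempty $S\subseteq V$ is a defensive $k$-alliance if $\delta_S(v)\ge\delta_{\bar S}(v)+k$ for all $v\in S$; its exact index of alliance is $k_S=\max\{k\in\mathcal{K}: S \text{ is a defensive } k\text{ -alliance}\}$. The alliance polynomial is $A(\Gamma;x)=\sum_{S} x^{n+k_S}$, the sum over all nonempty $S\subseteq V$ with induced subgraph $\langle S\rangle$ connected. -}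

module Defs where

open import Data.Bool using (Bool; true; false; _∧_; _∨_; not; if_then_else_)
open import Data.Nat using (ℕ; zero; suc; _+_; _*_; _∸_; _⊔_; _⊓_; _≤ᵇ_; _≡ᵇ_)
open import Data.Nat.Combinatorics using (_C_)
open import Data.Fin using (Fin; splitAt)
open import Data.Fin.Properties using (_≟_)
open import Data.List using (List; []; _∷_; length; filterᵇ; map; foldr; upTo; allFin; concatMap)
open import Data.Bool.ListAction using (all; any)
open import Data.Nat.ListAction using (sum)
open import Data.Vec using (Vec; lookup) renaming (_∷_ to _∷ᵛ_; [] to []ᵛ; map to mapᵛ)
open import Data.Sum using (_⊎_; inj₁; inj₂)
open import Relation.Nullary.Decidable using (⌊_⌋; yes; no)
open import Relation.Binary.PropositionalEquality using (_≡_; refl; sym)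

record Graph : Set where
  field
    order  : ℕ
    adj    : Fin order → Fin order → Bool
    adj-sym    : ∀ u v → adj u v ≡ adj v u
    adj-irrefl : ∀ v → adj v v ≡ false
open Graph public

_=ᶠ_ : ∀ {k} → Fin k → Fin k → Bool
u =ᶠ v = ⌊ u ≟ v ⌋

private
  =ᶠ-sym : ∀ {k} (u v : Fin k) → (u =ᶠ v) ≡ (v =ᶠ u)
  =ᶠ-sym u v with u ≟ v | v ≟ u
  ... | yes _ | yes _ = refl
  ... | no _  | no _  = refl
  ... | yes refl | no q = Data.Empty.⊥-elim (q refl) where import Data.Empty
  ... | no p  | yes refl = Data.Empty.⊥-elim (p refl) where import Data.Empty

  =ᶠ-refl : ∀ {k} (v : Fin k) → (v =ᶠ v) ≡ true
  =ᶠ-refl v with v ≟ v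
  ... | yes _ = refl
  ... | no p = Data.Empty.⊥-elim (p refl) where import Data.Empty

K : ℕ → Graph
K n = record
  { order = n
  ; adj = λ u v → not (u =ᶠ v)
  ; adj-sym = λ u v → Relation.Binary.PropositionalEquality.cong not (=ᶠ-sym u v)
  ; adj-irrefl = λ v → Relation.Binary.PropositionalEquality.cong not (=ᶠ-refl v)
  }

Kbar : ℕ → Graph
Kbar m = record
  { order = m ; adj = λ _ _ → false
  ; adj-sym = λ _ _ → refl ; adj-irrefl = λ _ → refl }

-- join Γ₁ ⊎ Γ₂ on vertex set Fin (order Γ₁ + order Γ₂):
-- the first order Γ₁ vertices are those of Γ₁, the rest those of Γ₂
joinAdj : (G H : Graph) → (Fin (order G) ⊎ Fin (order H)) → (Fin (order G) ⊎ Fin (order H)) → Bool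
joinAdj G H (inj₁ a) (inj₁ b) = adj G a b
joinAdj G H (inj₂ a) (inj₂ b) = adj H a b
joinAdj G H (inj₁ _) (inj₂ _) = true
joinAdj G H (inj₂ _) (inj₁ _) = true

private
  joinAdj-sym : ∀ G H x y → joinAdj G H x y ≡ joinAdj G H y x
  joinAdj-sym G H (inj₁ a) (inj₁ b) = adj-sym G a b
  joinAdj-sym G H (inj₂ a) (inj₂ b) = adj-sym H a b
  joinAdj-sym G H (inj₁ _) (inj₂ _) = refl
  joinAdj-sym G H (inj₂ _) (inj₁ _) = refl

  joinAdj-irrefl : ∀ G H x → joinAdj G H x x ≡ false
  joinAdj-irrefl G H (inj₁ a) = adj-irrefl G a
  joinAdj-irrefl G H (inj₂ a) = adj-irrefl H a

join : Graph → Graph → Graph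
join G H = record
  { order = order G + order H
  ; adj = λ u v → joinAdj G H (splitAt (order G) u) (splitAt (order G) v)
  ; adj-sym = λ u v → joinAdj-sym G H (splitAt (order G) u) (splitAt (order G) v)
  ; adj-irrefl = λ v → joinAdj-irrefl G H (splitAt (order G) v)
  }

Subset : ℕ → Set
Subset N = Vec Bool N

allSubsets : ∀ N → List (Subset N)
allSubsets zero = []ᵛ ∷ []
allSubsets (suc N) = concatMap (λ S → (true ∷ᵛ S) ∷ (false ∷ᵛ S) ∷ []) (allSubsets N)

count : ∀ {A : Set} → (A → Bool) → List A → ℕ
count p xs = length (filterᵇ p xs)

module _ (Γ : Graph) where
  private
    N = order Γ
    V = allFin N

  δ : Subset N → Fin N → ℕ
  δ X v = count (λ w → lookup X w ∧ adj Γ v w) V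

  complement : Subset N → Subset N
  complement S = mapᵛ not S

  δ₁ : ℕ
  δ₁ = foldr _⊔_ 0 (map (λ v → count (adj Γ v) V) V)

  nonempty : Subset N → Bool
  nonempty S = any (lookup S) V

  reach : Subset N → ℕ → Fin N → Fin N → Bool
  reach S zero u v = lookup S u ∧ (u =ᶠ v)
  reach S (suc k) u v =
    reach S k u v ∨ any (λ w → lookup S u ∧ adj Γ u w ∧ reach S k w v) V

  -- ⟨S⟩ connected: any two vertices of S are joined by a walk inside S
  -- (a walk of length ≤ N suffices, N being the order)
  connected : Subset N → Bool
  connected S = all (λ u → all (λ v →
    not (lookup S u ∧ lookup S v) ∨ reach S N u v) V) V

  -- S is a defensive k-alliance, written with e = n + k ∈ ℕ:
  --   δ_S(v) ≥ δ_{S̄}(v) + k   ⇔   δ_S(v) + n ≥ δ_{S̄}(v) + e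
  isAllianceShifted : Subset N → ℕ → Bool
  isAllianceShifted S e =
    all (λ v → not (lookup S v) ∨ (δ (complement S) v + e ≤ᵇ δ S v + N)) V

  -- n + k_S, where k_S = max { k ∈ [-δ₁, δ₁] : S defensive k-alliance };
  -- e = n + k ranges over [n - δ₁, n + δ₁] (note δ₁ ≤ n - 1, so n ∸ δ₁ = n - δ₁)
  allianceExponent : Subset N → ℕ
  allianceExponent S =
    foldr _⊔_ 0 (filterᵇ (λ e → (N ∸ δ₁ ≤ᵇ e) ∧ isAllianceShifted S e)
                         (upTo (suc (N + δ₁))))

  -- coefficient of x^j in the alliance polynomial A(Γ; x)
  A : ℕ → ℕ
  A j = count (λ S → nonempty S ∧ connected S ∧ (allianceExponent S ≡ᵇ j))
              (allSubsets N)

-- Polynomials with ℕ coefficients, represented by coefficient functions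
-- (coefficient of x^j at j); all polynomials here have finite support.

Poly : Set
Poly = ℕ → ℕ

_⊕_ : Poly → Poly → Poly
(p ⊕ q) j = p j + q j

_⊛_ : Poly → Poly → Poly
(p ⊛ q) j = sum (map (λ i → p i * q (j ∸ i)) (upTo (suc j)))

monomial : ℕ → ℕ → Poly
monomial c d j = if d ≡ᵇ j then c else 0

Ã : ℕ → Poly
Ã m j = sum (map (λ r → monomial (m C r) ((2 * r) ⊓ (m + 1)) j) (upTo (suc m)))

module Submission where

-- Write a vertex set of the join J as S = S₁ ∪ S₂ with S₁ ⊆ V(K_n), |S₁| = a, and S₂ ⊆ V(K̄_m),
-- |S₂| = r; everything relevant depends only on (a, r).
--  * Each v ∈ S has a slack c, defined by δ_S̄(v) + c = δ_S(v) + |V|: it is 2a - 1 + 2r on S₁ and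
--    2a + m on S₂. S is a defensive k-alliance iff |V| + k is at most every slack, so the exponent
--    |V| + k_S is the least slack present: 2a - 1 + min(2r, m + 1) if a ≥ 1, and m if S = {v} ⊆ K̄_m.
--  * S is connected iff a ≥ 1 (any two vertices are within distance 2 through S₁) or r = 1.
-- The same slack argument in K_n gives A(K_n; x) = Σ_{a≥1} C(n,a) x^{2a-1}. So the sets meeting K_n
-- contribute Σ_{a≥1} Σ_r C(n,a) C(m,r) x^{2a-1+min(2r,m+1)} = A(K_n; x) Ã_m(x), and the m singletons
-- of K̄_m contribute m x^m.

open import Defs
open import Function using (_∘_; id; case_of_)
open import Data.Bool using (Bool; true; false; _∧_; _∨_; not; T)
open import Data.Bool.Properties using (∧-zeroʳ; ∧-identityʳ)
open import Data.Bool.ListAction using (all; any)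
open import Data.Empty using (⊥; ⊥-elim)
open import Data.Unit using (tt)
open import Data.Product using (Σ; _×_; _,_; proj₁; proj₂)
open import Data.Sum using (inj₁; inj₂; [_,_]′)
open import Data.Nat
  using (ℕ; zero; suc; _+_; _*_; _∸_; _⊔_; _⊓_; _≤ᵇ_; _≡ᵇ_; _<ᵇ_; _≤_; _<_; _≥_; z≤n; s≤s)
open import Data.Nat.Properties hiding (_≟_)
open import Data.Nat.Combinatorics using (_C_; nC1≡n; k>n⇒nCk≡0; nCk+nC[k+1]≡[n+1]C[k+1])
open import Data.Nat.ListAction using (sum)
open import Data.Nat.ListAction.Properties using (sum-++)
open import Data.Nat.Solver using (module +-*-Solver)
open import Data.Fin using (Fin; zero; suc; _↑ˡ_; _↑ʳ_; splitAt)
open import Data.Fin.Properties using (_≟_; splitAt-↑ˡ; splitAt-↑ʳ; join-splitAt)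
open import Data.List
  using (List; []; _∷_; _++_; length; filterᵇ; map; foldr; upTo; applyUpTo; allFin; concatMap; tabulate)
open import Data.List.Properties using (map-++; map-cong; map-tabulate; length-tabulate; map-∘)
open import Data.List.Membership.Propositional using (_∈_)
open import Data.List.Membership.Propositional.Properties using (∈-allFin; ∈-upTo⁺; ∈-map⁺)
open import Data.List.Relation.Unary.Any using (here; there)
open import Data.Vec using (lookup) renaming (_∷_ to _∷ᵛ_; _++_ to _++ᵛ_)
open import Data.Vec.Properties using (lookup-map; lookup-++ˡ; lookup-++ʳ) renaming (map-++ to map-++ᵛ)
open import Relation.Binary.PropositionalEquality hiding (J)
open import Relation.Nullary using (yes; no)

open +-*-Solver using (solve; _:+_; _:*_; _:=_; con)
open ≡-Reasoning

private
  variable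
    α β : Set

𝟙 : Bool → ℕ
𝟙 true  = 1
𝟙 false = 0

count-∷ : (p : α → Bool) (x : α) (xs : List α) → count p (x ∷ xs) ≡ 𝟙 (p x) + count p xs
count-∷ p x xs with p x
... | true  = refl
... | false = refl

count-++ : (p : α → Bool) (xs ys : List α) → count p (xs ++ ys) ≡ count p xs + count p ys
count-++ p []       ys = refl
count-++ p (x ∷ xs) ys = begin
  count p (x ∷ xs ++ ys)          ≡⟨ count-∷ p x (xs ++ ys) ⟩
  𝟙 (p x) + count p (xs ++ ys)     ≡⟨ cong (𝟙 (p x) +_) (count-++ p xs ys) ⟩
  𝟙 (p x) + (count p xs + count p ys) ≡⟨ +-assoc (𝟙 (p x)) _ _ ⟨
  𝟙 (p x) + count p xs + count p ys   ≡⟨ cong (_+ count p ys) (count-∷ p x xs) ⟨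
  count p (x ∷ xs) + count p ys ∎

count≡sum-𝟙 : (p : α → Bool) (xs : List α) → count p xs ≡ sum (map (𝟙 ∘ p) xs)
count≡sum-𝟙 p []       = refl
count≡sum-𝟙 p (x ∷ xs) = trans (count-∷ p x xs) (cong (𝟙 (p x) +_) (count≡sum-𝟙 p xs))

count-cong : {p q : α → Bool} (xs : List α) → (∀ x → p x ≡ q x) → count p xs ≡ count q xs
count-cong {p = p} {q} []       e = refl
count-cong {p = p} {q} (x ∷ xs) e = begin
  count p (x ∷ xs)          ≡⟨ count-∷ p x xs ⟩
  𝟙 (p x) + count p xs      ≡⟨ cong₂ _+_ (cong 𝟙 (e x)) (count-cong xs e) ⟩
  𝟙 (q x) + count q xs      ≡⟨ count-∷ q x xs ⟨
  count q (x ∷ xs) ∎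

count-map : (p : β → Bool) (f : α → β) (xs : List α) → count p (map f xs) ≡ count (p ∘ f) xs
count-map p f []       = refl
count-map p f (x ∷ xs) = begin
  count p (f x ∷ map f xs)           ≡⟨ count-∷ p (f x) (map f xs) ⟩
  𝟙 (p (f x)) + count p (map f xs)   ≡⟨ cong (𝟙 (p (f x)) +_) (count-map p f xs) ⟩
  𝟙 (p (f x)) + count (p ∘ f) xs     ≡⟨ count-∷ (p ∘ f) x xs ⟨
  count (p ∘ f) (x ∷ xs) ∎

count-false : (p : α → Bool) (xs : List α) → (∀ x → p x ≡ false) → count p xs ≡ 0
count-false p []       h = refl
count-false p (x ∷ xs) h = trans (count-∷ p x xs) (cong₂ _+_ (cong 𝟙 (h x)) (count-false p xs h))

count-split : (p q : α → Bool) (xs : List α) →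
  count p xs ≡ count (λ x → p x ∧ q x) xs + count (λ x → p x ∧ not (q x)) xs
count-split p q [] = refl
count-split p q (x ∷ xs)
  rewrite count-∷ p x xs | count-∷ (λ x → p x ∧ q x) x xs
        | count-∷ (λ x → p x ∧ not (q x)) x xs | count-split p q xs
  with p x | q x
... | true  | true  = refl
... | true  | false = sym (+-suc _ _)
... | false | _     = refl

count+count-not : (p : α → Bool) (xs : List α) → count p xs + count (not ∘ p) xs ≡ length xs
count+count-not p [] = refl
count+count-not p (x ∷ xs) rewrite count-∷ p x xs | count-∷ (not ∘ p) x xs with p x
... | true  = cong suc (count+count-not p xs)
... | false = trans (+-suc _ _) (cong suc (count+count-not p xs))

count-mono : (p q : α → Bool) (xs : List α) → (∀ x → p x ≡ true → q x ≡ true) → count p xs ≤ count q xs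
count-mono p q [] h = z≤n
count-mono p q (x ∷ xs) h rewrite count-∷ p x xs | count-∷ q x xs with p x in px
... | true  rewrite h x px = s≤s (count-mono p q xs h)
... | false = ≤-trans (count-mono p q xs h) (m≤n+m _ (𝟙 (q x)))

any≡count≢0 : (p : α → Bool) (xs : List α) → any p xs ≡ not (count p xs ≡ᵇ 0)
any≡count≢0 p [] = refl
any≡count≢0 p (x ∷ xs) rewrite count-∷ p x xs with p x
... | true  = refl
... | false = any≡count≢0 p xs

or-right : ∀ {b c} → c ≡ true → b ∨ c ≡ true
or-right {true}  _ = refl
or-right {false} e = e

all-intro : (p : α → Bool) (xs : List α) → (∀ x → p x ≡ true) → all p xs ≡ true
all-intro p []       h = refl
all-intro p (x ∷ xs) h rewrite h x = all-intro p xs h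

all-elim : (p : α → Bool) (xs : List α) {x : α} → all p xs ≡ true → x ∈ xs → p x ≡ true
all-elim p (y ∷ xs) e x∈ with p y in py
all-elim p (y ∷ xs) e (here refl) | true = py
all-elim p (y ∷ xs) e (there x∈)  | true = all-elim p xs e x∈

all-false : (p : α → Bool) (xs : List α) → all p xs ≡ false → Σ α λ x → p x ≡ false
all-false p (x ∷ xs) e with p x in px
... | true  = all-false p xs e
... | false = x , px

all-mono : (p q : α → Bool) (xs : List α) → (∀ x → p x ≡ true → q x ≡ true) →
  all p xs ≡ true → all q xs ≡ true
all-mono p q []       h e = refl
all-mono p q (x ∷ xs) h e with p x in px
... | true rewrite h x px = all-mono p q xs h e

any-intro : (p : α → Bool) (xs : List α) {x : α} → x ∈ xs → p x ≡ true → any p xs ≡ true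
any-intro p (y ∷ xs) (here refl) e rewrite e = refl
any-intro p (y ∷ xs) (there x∈)  e with p y
... | true  = refl
... | false = any-intro p xs x∈ e

any-elim : (p : α → Bool) (xs : List α) → any p xs ≡ true → Σ α λ x → p x ≡ true
any-elim p (x ∷ xs) e with p x in px
... | true  = x , px
... | false = any-elim p xs e

all-++ : (p : α → Bool) (xs ys : List α) → all p (xs ++ ys) ≡ all p xs ∧ all p ys
all-++ p []       ys = refl
all-++ p (x ∷ xs) ys with p x
... | true  = all-++ p xs ys
... | false = refl

all-cong : {p q : α → Bool} (xs : List α) → (∀ x → p x ≡ q x) → all p xs ≡ all q xs
all-cong xs e = cong (foldr _∧_ true) (map-cong e xs)

all-map : (p : β → Bool) (f : α → β) (xs : List α) → all p (map f xs) ≡ all (p ∘ f) xs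
all-map p f xs = cong (foldr _∧_ true) (sym (map-∘ xs))

all-guarded : (f : α → Bool) (b : Bool) (xs : List α) → all (λ x → not (f x) ∨ b) xs ≡ not (any f xs) ∨ b
all-guarded f b []       = refl
all-guarded f b (x ∷ xs) with f x
... | false = all-guarded f b xs
... | true rewrite all-guarded f b xs = absorb b (not (any f xs))
  where
  absorb : ∀ b a → b ∧ (a ∨ b) ≡ b
  absorb true  true  = refl
  absorb true  false = refl
  absorb false a     = refl

=ᶠ-refl : ∀ {k} (v : Fin k) → (v =ᶠ v) ≡ true
=ᶠ-refl v with v ≟ v
... | yes _ = refl
... | no v≢v = ⊥-elim (v≢v refl)

=ᶠ-sound : ∀ {k} (u v : Fin k) → (u =ᶠ v) ≡ true → u ≡ v
=ᶠ-sound u v e with u ≟ v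
... | yes u≡v = u≡v

=ᶠ-false : ∀ {k} (u v : Fin k) → (u ≡ v → ⊥) → (u =ᶠ v) ≡ false
=ᶠ-false u v u≢v with u ≟ v
... | yes u≡v = ⊥-elim (u≢v u≡v)
... | no _    = refl

=ᶠ-suc : ∀ {k} (u v : Fin k) → (suc u =ᶠ suc v) ≡ (u =ᶠ v)
=ᶠ-suc u v with u ≟ v
... | yes _ = refl
... | no _  = refl

Fin⇒1≤ : ∀ {N} → Fin N → 1 ≤ N
Fin⇒1≤ zero    = s≤s z≤n
Fin⇒1≤ (suc _) = s≤s z≤n

count-allFin-suc : ∀ n (f : Fin (suc n) → Bool) →
  count f (allFin (suc n)) ≡ 𝟙 (f zero) + count (f ∘ suc) (allFin n)
count-allFin-suc n f = begin
  count f (zero ∷ tabulate suc)          ≡⟨ count-∷ f zero (tabulate suc) ⟩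
  𝟙 (f zero) + count f (tabulate suc)    ≡⟨ cong (λ xs → 𝟙 (f zero) + count f xs) (map-tabulate id suc) ⟨
  𝟙 (f zero) + count f (map suc (allFin n)) ≡⟨ cong (𝟙 (f zero) +_) (count-map f suc (allFin n)) ⟩
  𝟙 (f zero) + count (f ∘ suc) (allFin n) ∎

count-only : ∀ n (f : Fin n → Bool) (v : Fin n) → count (λ w → f w ∧ (v =ᶠ w)) (allFin n) ≡ 𝟙 (f v)
count-only (suc n) f zero = begin
  count (λ w → f w ∧ (zero =ᶠ w)) (allFin (suc n))
    ≡⟨ count-allFin-suc n (λ w → f w ∧ (zero =ᶠ w)) ⟩
  𝟙 (f zero ∧ true) + count (λ w → f (suc w) ∧ false) (allFin n)
    ≡⟨ cong₂ _+_ (cong 𝟙 (∧-identityʳ (f zero))) (count-false _ (allFin n) (λ w → ∧-zeroʳ (f (suc w)))) ⟩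
  𝟙 (f zero) + 0
    ≡⟨ +-identityʳ _ ⟩
  𝟙 (f zero) ∎
count-only (suc n) f (suc v) = begin
  count (λ w → f w ∧ (suc v =ᶠ w)) (allFin (suc n))
    ≡⟨ count-allFin-suc n (λ w → f w ∧ (suc v =ᶠ w)) ⟩
  𝟙 (f zero ∧ false) + count (λ w → f (suc w) ∧ (suc v =ᶠ suc w)) (allFin n)
    ≡⟨ cong₂ _+_ (cong 𝟙 (∧-zeroʳ (f zero))) (count-cong (allFin n) (λ w → cong (f (suc w) ∧_) (=ᶠ-suc v w))) ⟩
  count (λ w → f (suc w) ∧ (v =ᶠ w)) (allFin n)
    ≡⟨ count-only n (f ∘ suc) v ⟩
  𝟙 (f (suc v)) ∎

count-except : ∀ n (f : Fin n → Bool) (v : Fin n) →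
  count (λ w → f w ∧ not (v =ᶠ w)) (allFin n) + 𝟙 (f v) ≡ count f (allFin n)
count-except n f v = begin
  away + 𝟙 (f v)                                    ≡⟨ +-comm away (𝟙 (f v)) ⟩
  𝟙 (f v) + away                                    ≡⟨ cong (_+ away) (count-only n f v) ⟨
  count (λ w → f w ∧ (v =ᶠ w)) (allFin n) + away    ≡⟨ count-split f (v =ᶠ_) (allFin n) ⟨
  count f (allFin n) ∎
  where
  away : ℕ
  away = count (λ w → f w ∧ not (v =ᶠ w)) (allFin n)

sumTo : ℕ → (ℕ → ℕ) → ℕ
sumTo zero    f = 0
sumTo (suc n) f = f 0 + sumTo n (f ∘ suc)

sumTo-cong : ∀ n {f g : ℕ → ℕ} → (∀ i → f i ≡ g i) → sumTo n f ≡ sumTo n g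
sumTo-cong zero    e = refl
sumTo-cong (suc n) e = cong₂ _+_ (e 0) (sumTo-cong n (e ∘ suc))

sumTo-zero : ∀ n (f : ℕ → ℕ) → (∀ i → f i ≡ 0) → sumTo n f ≡ 0
sumTo-zero zero    f e = refl
sumTo-zero (suc n) f e = cong₂ _+_ (e 0) (sumTo-zero n (f ∘ suc) (e ∘ suc))

sumTo-+ : ∀ n (f g : ℕ → ℕ) → sumTo n (λ i → f i + g i) ≡ sumTo n f + sumTo n g
sumTo-+ zero    f g = refl
sumTo-+ (suc n) f g = begin
  f 0 + g 0 + sumTo n (λ i → f (suc i) + g (suc i)) ≡⟨ cong (f 0 + g 0 +_) (sumTo-+ n (f ∘ suc) (g ∘ suc)) ⟩
  f 0 + g 0 + (F + G)                                ≡⟨ solve 4 (λ a b c d → a :+ b :+ (c :+ d) := a :+ c :+ (b :+ d)) refl (f 0) (g 0) F G ⟩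
  f 0 + F + (g 0 + G) ∎
  where
  F G : ℕ
  F = sumTo n (f ∘ suc)
  G = sumTo n (g ∘ suc)

sumTo-*ˡ : ∀ n c (f : ℕ → ℕ) → sumTo n (λ i → c * f i) ≡ c * sumTo n f
sumTo-*ˡ zero    c f = sym (*-zeroʳ c)
sumTo-*ˡ (suc n) c f = trans (cong (c * f 0 +_) (sumTo-*ˡ n c (f ∘ suc))) (sym (*-distribˡ-+ c (f 0) _))

sumTo-*ʳ : ∀ n c (f : ℕ → ℕ) → sumTo n (λ i → f i * c) ≡ sumTo n f * c
sumTo-*ʳ n c f = begin
  sumTo n (λ i → f i * c) ≡⟨ sumTo-cong n (λ i → *-comm (f i) c) ⟩
  sumTo n (λ i → c * f i) ≡⟨ sumTo-*ˡ n c f ⟩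
  c * sumTo n f           ≡⟨ *-comm c _ ⟩
  sumTo n f * c ∎

sumTo-last : ∀ n (f : ℕ → ℕ) → sumTo (suc n) f ≡ sumTo n f + f n
sumTo-last zero    f = +-comm (f 0) 0
sumTo-last (suc n) f = trans (cong (f 0 +_) (sumTo-last n (f ∘ suc))) (sym (+-assoc (f 0) _ _))

sumTo-swap : ∀ n m (f : ℕ → ℕ → ℕ) →
  sumTo n (λ i → sumTo m (f i)) ≡ sumTo m (λ k → sumTo n (λ i → f i k))
sumTo-swap zero    m f = sym (sumTo-zero m _ (λ _ → refl))
sumTo-swap (suc n) m f = begin
  sumTo m (f 0) + sumTo n (λ i → sumTo m (f (suc i)))       ≡⟨ cong (sumTo m (f 0) +_) (sumTo-swap n m (f ∘ suc)) ⟩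
  sumTo m (f 0) + sumTo m (λ k → sumTo n (λ i → f (suc i) k)) ≡⟨ sumTo-+ m (f 0) (λ k → sumTo n (λ i → f (suc i) k)) ⟨
  sumTo m (λ k → sumTo (suc n) (λ i → f i k)) ∎

sumTo-pick : ∀ N c (h : ℕ → ℕ) → sumTo N (λ i → 𝟙 (c ≡ᵇ i) * h i) ≡ 𝟙 (c <ᵇ N) * h c
sumTo-pick zero    c       h = refl
sumTo-pick (suc N) zero    h = trans (cong (h 0 + 0 +_) (sumTo-zero N _ (λ _ → refl))) (+-identityʳ _)
sumTo-pick (suc N) (suc c) h = sumTo-pick N c (h ∘ suc)

sum-upTo : ∀ n (f : ℕ → ℕ) → sum (map f (upTo n)) ≡ sumTo n f
sum-upTo n f = sum-applyUpTo n id
  where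
  sum-applyUpTo : ∀ n (g : ℕ → ℕ) → sum (map f (applyUpTo g n)) ≡ sumTo n (f ∘ g)
  sum-applyUpTo zero    g = refl
  sum-applyUpTo (suc n) g = cong (f (g 0) +_) (sum-applyUpTo n (g ∘ suc))

sum-map-+ : (f g : α → ℕ) (xs : List α) → sum (map (λ x → f x + g x) xs) ≡ sum (map f xs) + sum (map g xs)
sum-map-+ f g []       = refl
sum-map-+ f g (x ∷ xs) = begin
  f x + g x + sum (map (λ x → f x + g x) xs) ≡⟨ cong (f x + g x +_) (sum-map-+ f g xs) ⟩
  f x + g x + (F + G)                        ≡⟨ solve 4 (λ a b c d → a :+ b :+ (c :+ d) := a :+ c :+ (b :+ d)) refl (f x) (g x) F G ⟩
  f x + F + (g x + G) ∎
  where
  F G : ℕ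
  F = sum (map f xs)
  G = sum (map g xs)

sum-concatMap : (w : β → ℕ) (h : α → List β) (xs : List α) →
  sum (map w (concatMap h xs)) ≡ sum (map (λ x → sum (map w (h x))) xs)
sum-concatMap w h []       = refl
sum-concatMap w h (x ∷ xs) = begin
  sum (map w (h x ++ concatMap h xs))              ≡⟨ cong sum (map-++ w (h x) _) ⟩
  sum (map w (h x) ++ map w (concatMap h xs))      ≡⟨ sum-++ (map w (h x)) _ ⟩
  sum (map w (h x)) + sum (map w (concatMap h xs)) ≡⟨ cong (sum (map w (h x)) +_) (sum-concatMap w h xs) ⟩
  sum (map w (h x)) + sum (map (λ x → sum (map w (h x))) xs) ∎

sumS : ∀ n → (Subset n → ℕ) → ℕ
sumS n w = sum (map w (allSubsets n))

sumS-cong : ∀ n {f g : Subset n → ℕ} → (∀ S → f S ≡ g S) → sumS n f ≡ sumS n g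
sumS-cong n e = cong sum (map-cong e (allSubsets n))

sumS-suc : ∀ n (w : Subset (suc n) → ℕ) → sumS (suc n) w ≡ sumS n (λ S → w (true ∷ᵛ S) + w (false ∷ᵛ S))
sumS-suc n w = trans (sum-concatMap w _ (allSubsets n))
                     (sumS-cong n (λ S → cong (w (true ∷ᵛ S) +_) (+-identityʳ _)))

sumS-+ : ∀ n (f g : Subset n → ℕ) → sumS n (λ S → f S + g S) ≡ sumS n f + sumS n g
sumS-+ n f g = sum-map-+ f g (allSubsets n)

sumS-++ : ∀ n m (w : Subset (n + m) → ℕ) → sumS (n + m) w ≡ sumS n (λ S₁ → sumS m (λ S₂ → w (S₁ ++ᵛ S₂)))
sumS-++ zero    m w = sym (+-identityʳ _)
sumS-++ (suc n) m w = begin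
  sumS (suc n + m) w
    ≡⟨ sumS-suc (n + m) w ⟩
  sumS (n + m) (λ S → w (true ∷ᵛ S) + w (false ∷ᵛ S))
    ≡⟨ sumS-+ (n + m) _ _ ⟩
  sumS (n + m) (λ S → w (true ∷ᵛ S)) + sumS (n + m) (λ S → w (false ∷ᵛ S))
    ≡⟨ cong₂ _+_ (sumS-++ n m _) (sumS-++ n m _) ⟩
  sumS n (λ S₁ → sumS m (λ S₂ → w (true ∷ᵛ (S₁ ++ᵛ S₂)))) + sumS n (λ S₁ → sumS m (λ S₂ → w (false ∷ᵛ (S₁ ++ᵛ S₂))))
    ≡⟨ sumS-+ n _ _ ⟨
  sumS n (λ S₁ → sumS m (λ S₂ → w (true ∷ᵛ (S₁ ++ᵛ S₂))) + sumS m (λ S₂ → w (false ∷ᵛ (S₁ ++ᵛ S₂))))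
    ≡⟨ sumS-suc n _ ⟨
  sumS (suc n) (λ S₁ → sumS m (λ S₂ → w (S₁ ++ᵛ S₂))) ∎

size : ∀ {n} → Subset n → ℕ
size {n} S = count (lookup S) (allFin n)

size-∷ : ∀ {n} (b : Bool) (S : Subset n) → size (b ∷ᵛ S) ≡ 𝟙 b + size S
size-∷ {n} b S = count-allFin-suc n (lookup (b ∷ᵛ S))

binomial-sum-suc : ∀ n (g : ℕ → ℕ) →
  sumTo (suc (suc n)) (λ a → (suc n C a) * g a)
    ≡ sumTo (suc n) (λ a → (n C a) * g (suc a)) + sumTo (suc n) (λ a → (n C a) * g a)
binomial-sum-suc n g = begin
  g 0 + 0 + sumTo (suc n) (λ a → (suc n C suc a) * g (suc a))
    ≡⟨ cong₂ _+_ (+-identityʳ (g 0)) (sumTo-cong (suc n) pascal) ⟩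
  g 0 + sumTo (suc n) (λ a → (n C a) * g (suc a) + (n C suc a) * g (suc a))
    ≡⟨ cong (g 0 +_) (sumTo-+ (suc n) (λ a → (n C a) * g (suc a)) (λ a → (n C suc a) * g (suc a))) ⟩
  g 0 + (P + R)
    ≡⟨ cong (λ z → g 0 + (P + z)) (sumTo-last n (λ a → (n C suc a) * g (suc a))) ⟩
  g 0 + (P + (Q + (n C suc n) * g (suc n)))
    ≡⟨ cong (λ z → g 0 + (P + (Q + z * g (suc n)))) (k>n⇒nCk≡0 (n<1+n n)) ⟩
  g 0 + (P + (Q + 0))
    ≡⟨ solve 3 (λ a p q → a :+ (p :+ (q :+ con 0)) := p :+ (a :+ con 0 :+ q)) refl (g 0) P Q ⟩
  P + (g 0 + 0 + Q) ∎
  where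
  P Q R : ℕ
  P = sumTo (suc n) (λ a → (n C a) * g (suc a))
  Q = sumTo n (λ a → (n C suc a) * g (suc a))
  R = sumTo (suc n) (λ a → (n C suc a) * g (suc a))
  pascal : ∀ a → (suc n C suc a) * g (suc a) ≡ (n C a) * g (suc a) + (n C suc a) * g (suc a)
  pascal a = trans (cong (_* g (suc a)) (sym (nCk+nC[k+1]≡[n+1]C[k+1] n a))) (*-distribʳ-+ (g (suc a)) (n C a) _)

sumS-by-size : ∀ n (g : ℕ → ℕ) → sumS n (g ∘ size) ≡ sumTo (suc n) (λ a → (n C a) * g a)
sumS-by-size zero    g = cong (_+ 0) (sym (*-identityˡ (g 0)))
sumS-by-size (suc n) g = begin
  sumS (suc n) (g ∘ size)
    ≡⟨ sumS-suc n (g ∘ size) ⟩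
  sumS n (λ S → g (size (true ∷ᵛ S)) + g (size (false ∷ᵛ S)))
    ≡⟨ sumS-+ n _ _ ⟩
  sumS n (λ S → g (size (true ∷ᵛ S))) + sumS n (λ S → g (size (false ∷ᵛ S)))
    ≡⟨ cong₂ _+_ (sumS-cong n (λ S → cong g (size-∷ true S))) (sumS-cong n (λ S → cong g (size-∷ false S))) ⟩
  sumS n (g ∘ suc ∘ size) + sumS n (g ∘ size)
    ≡⟨ cong₂ _+_ (sumS-by-size n (g ∘ suc)) (sumS-by-size n g) ⟩
  sumTo (suc n) (λ a → (n C a) * g (suc a)) + sumTo (suc n) (λ a → (n C a) * g a)
    ≡⟨ binomial-sum-suc n g ⟨
  sumTo (suc (suc n)) (λ a → (suc n C a) * g a) ∎

others : ∀ {N} → Subset N → Fin N → ℕ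
others {N} S k = count (λ w → lookup S w ∧ not (k =ᶠ w)) (allFin N)

others+1≡size : ∀ {N} (S : Subset N) k → lookup S k ≡ true → others S k + 1 ≡ size S
others+1≡size {N} S k k∈S = trans (cong (λ b → others S k + 𝟙 b) (sym k∈S)) (count-except N (lookup S) k)

size≡0⇒∉ : ∀ {N} (S : Subset N) k → size S ≡ 0 → lookup S k ≡ false
size≡0⇒∉ S k |S|≡0 with lookup S k in k∈S
... | false = refl
... | true  = case trans (+-comm 1 (others S k)) (trans (others+1≡size S k k∈S) |S|≡0) of λ ()

size≢0⇒member : ∀ {N a} (S : Subset N) → size S ≡ suc a → Σ (Fin N) λ k → lookup S k ≡ true
size≢0⇒member {N} S |S|≡1+a =
  any-elim (lookup S) (allFin N) (trans (any≡count≢0 (lookup S) (allFin N)) (cong (λ c → not (c ≡ᵇ 0)) |S|≡1+a))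

size≡1⇒unique : ∀ {N} (S : Subset N) k l → size S ≡ 1 → lookup S k ≡ true → lookup S l ≡ true → k ≡ l
size≡1⇒unique {N} S k l |S|≡1 k∈S l∈S with k =ᶠ l in k=l
... | true  = =ᶠ-sound k l k=l
... | false = case trans (sym no-others) l-other of λ ()
  where
  no-others : any (λ w → lookup S w ∧ not (k =ᶠ w)) (allFin N) ≡ false
  no-others = trans (any≡count≢0 _ (allFin N))
                    (cong (λ c → not (c ≡ᵇ 0)) (+-cancelʳ-≡ 1 (others S k) 0 (trans (others+1≡size S k k∈S) |S|≡1)))
  l-other : any (λ w → lookup S w ∧ not (k =ᶠ w)) (allFin N) ≡ true
  l-other = any-intro _ (allFin N) (∈-allFin l) (cong₂ _∧_ l∈S (cong not k=l))

size≥2⇒distinct : ∀ {N r} (S : Subset N) → size S ≡ suc (suc r) →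
  Σ (Fin N) λ k → Σ (Fin N) λ l → (lookup S k ≡ true) × (lookup S l ≡ true) × (k ≡ l → ⊥)
size≥2⇒distinct {N} {r} S |S|≡2+r with size≢0⇒member S |S|≡2+r
... | k , k∈S with any-elim (λ w → lookup S w ∧ not (k =ᶠ w)) (allFin N) another
  where
  others≡1+r : others S k ≡ suc r
  others≡1+r = +-cancelʳ-≡ 1 _ _ (trans (others+1≡size S k k∈S) (trans |S|≡2+r (+-comm 1 (suc r))))
  another : any (λ w → lookup S w ∧ not (k =ᶠ w)) (allFin N) ≡ true
  another = trans (any≡count≢0 _ (allFin N)) (cong (λ c → not (c ≡ᵇ 0)) others≡1+r)
... | l , p = k , l , k∈S , in-S , distinct
  where
  in-S : lookup S l ≡ true
  in-S with lookup S l
  ... | true  = refl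
  ... | false = case p of λ ()
  distinct : k ≡ l → ⊥
  distinct refl rewrite =ᶠ-refl k | ∧-zeroʳ (lookup S k) = case p of λ ()

monomials : ℕ → (ℕ → ℕ) → (ℕ → ℕ) → Poly
monomials N p d i = sumTo N (λ a → p a * 𝟙 (d a ≡ᵇ i))

𝟙-∧ : ∀ b c → 𝟙 (b ∧ c) ≡ 𝟙 b * 𝟙 c
𝟙-∧ true  c = sym (+-identityʳ (𝟙 c))
𝟙-∧ false c = refl

monomial≡𝟙 : ∀ c d k → monomial c d k ≡ c * 𝟙 (d ≡ᵇ k)
monomial≡𝟙 c d k with d ≡ᵇ k
... | true  = sym (*-identityʳ c)
... | false = sym (*-zeroʳ c)

𝟙-difference : ∀ c d j → 𝟙 (c <ᵇ suc j) * 𝟙 (d ≡ᵇ j ∸ c) ≡ 𝟙 (c + d ≡ᵇ j)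
𝟙-difference zero    d j       = +-identityʳ _
𝟙-difference (suc c) d zero    = refl
𝟙-difference (suc c) d (suc j) = 𝟙-difference c d j

⊛-cong : ∀ {P P' Q Q' : Poly} → (∀ i → P i ≡ P' i) → (∀ i → Q i ≡ Q' i) → ∀ j → (P ⊛ Q) j ≡ (P' ⊛ Q') j
⊛-cong P≗P' Q≗Q' j = cong sum (map-cong (λ i → cong₂ _*_ (P≗P' i) (Q≗Q' (j ∸ i))) (upTo (suc j)))

⊛-monomials : ∀ N p d₁ M q d₂ j →
  (monomials N p d₁ ⊛ monomials M q d₂) j ≡ sumTo N (λ a → p a * sumTo M (λ r → q r * 𝟙 (d₁ a + d₂ r ≡ᵇ j)))
⊛-monomials N p d₁ M q d₂ j = begin
  (P ⊛ Q) j
    ≡⟨ sum-upTo (suc j) (λ i → P i * Q (j ∸ i)) ⟩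
  sumTo (suc j) (λ i → P i * Q (j ∸ i))
    ≡⟨ sumTo-cong (suc j) (λ i → sym (sumTo-*ʳ N (Q (j ∸ i)) (λ a → p a * 𝟙 (d₁ a ≡ᵇ i)))) ⟩
  sumTo (suc j) (λ i → sumTo N (λ a → p a * 𝟙 (d₁ a ≡ᵇ i) * Q (j ∸ i)))
    ≡⟨ sumTo-swap (suc j) N (λ i a → p a * 𝟙 (d₁ a ≡ᵇ i) * Q (j ∸ i)) ⟩
  sumTo N (λ a → sumTo (suc j) (λ i → p a * 𝟙 (d₁ a ≡ᵇ i) * Q (j ∸ i)))
    ≡⟨ sumTo-cong N fixed-a ⟨
  sumTo N (λ a → p a * sumTo M (λ r → q r * 𝟙 (d₁ a + d₂ r ≡ᵇ j))) ∎
  where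
  P Q : Poly
  P = monomials N p d₁
  Q = monomials M q d₂
  -- For fixed a only the term i = d₁ a of the inner sum survives.
  fixed-a : ∀ a → p a * sumTo M (λ r → q r * 𝟙 (d₁ a + d₂ r ≡ᵇ j))
                  ≡ sumTo (suc j) (λ i → p a * 𝟙 (d₁ a ≡ᵇ i) * Q (j ∸ i))
  fixed-a a = begin
    p a * sumTo M (λ r → q r * 𝟙 (d₁ a + d₂ r ≡ᵇ j))
      ≡⟨ cong (p a *_) (sumTo-cong M (λ r → trans (cong (q r *_) (sym (𝟙-difference (d₁ a) (d₂ r) j)))
            (solve 3 (λ q c d → q :* (c :* d) := c :* (q :* d)) refl (q r) (𝟙 (d₁ a <ᵇ suc j)) (𝟙 (d₂ r ≡ᵇ j ∸ d₁ a))))) ⟩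
    p a * sumTo M (λ r → 𝟙 (d₁ a <ᵇ suc j) * (q r * 𝟙 (d₂ r ≡ᵇ j ∸ d₁ a)))
      ≡⟨ cong (p a *_) (sumTo-*ˡ M (𝟙 (d₁ a <ᵇ suc j)) (λ r → q r * 𝟙 (d₂ r ≡ᵇ j ∸ d₁ a))) ⟩
    p a * (𝟙 (d₁ a <ᵇ suc j) * Q (j ∸ d₁ a))
      ≡⟨ cong (p a *_) (sumTo-pick (suc j) (d₁ a) (λ i → Q (j ∸ i))) ⟨
    p a * sumTo (suc j) (λ i → 𝟙 (d₁ a ≡ᵇ i) * Q (j ∸ i))
      ≡⟨ sumTo-*ˡ (suc j) (p a) (λ i → 𝟙 (d₁ a ≡ᵇ i) * Q (j ∸ i)) ⟨
    sumTo (suc j) (λ i → p a * (𝟙 (d₁ a ≡ᵇ i) * Q (j ∸ i)))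
      ≡⟨ sumTo-cong (suc j) (λ i → sym (*-assoc (p a) (𝟙 (d₁ a ≡ᵇ i)) (Q (j ∸ i)))) ⟩
    sumTo (suc j) (λ i → p a * 𝟙 (d₁ a ≡ᵇ i) * Q (j ∸ i)) ∎

≤ᵇ-sound : ∀ {m n} → (m ≤ᵇ n) ≡ true → m ≤ n
≤ᵇ-sound {m} {n} e = ≤ᵇ⇒≤ m n (subst T (sym e) tt)

≤ᵇ-complete : ∀ {m n} → m ≤ n → (m ≤ᵇ n) ≡ true
≤ᵇ-complete {m} {n} m≤n with m ≤ᵇ n | ≤⇒≤ᵇ m≤n
... | true | _ = refl

≤ᵇ-false-sound : ∀ {m n} → (m ≤ᵇ n) ≡ false → n < m
≤ᵇ-false-sound {m} {n} e with m ≤? n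
... | yes m≤n = case trans (sym e) (≤ᵇ-complete m≤n) of λ ()
... | no m≰n = ≰⇒> m≰n

≤ᵇ-false-complete : ∀ {m n} → n < m → (m ≤ᵇ n) ≡ false
≤ᵇ-false-complete {m} {n} n<m with m ≤ᵇ n in e
... | true  = ⊥-elim (<⇒≱ n<m (≤ᵇ-sound e))
... | false = refl

+-≤ᵇ-cancel : ∀ x y c e → x + c ≡ y → (x + e ≤ᵇ y) ≡ (e ≤ᵇ c)
+-≤ᵇ-cancel x y c e x+c≡y with e ≤ᵇ c in e?c
... | true  = ≤ᵇ-complete (subst (x + e ≤_) x+c≡y (+-monoʳ-≤ x (≤ᵇ-sound e?c)))
... | false = ≤ᵇ-false-complete (subst (_< x + e) x+c≡y (+-monoʳ-< x (≤ᵇ-false-sound e?c)))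

≤ᵇ-⊓ : ∀ e x y → (e ≤ᵇ x) ∧ (e ≤ᵇ y) ≡ (e ≤ᵇ x ⊓ y)
≤ᵇ-⊓ e x y with e ≤ᵇ x in e≤x | e ≤ᵇ y in e≤y
... | true  | true  = sym (≤ᵇ-complete {e} {x ⊓ y} (⊓-glb (≤ᵇ-sound {e} {x} e≤x) (≤ᵇ-sound {e} {y} e≤y)))
... | false | _     = sym (≤ᵇ-false-complete {e} {x ⊓ y} (≤-<-trans (m⊓n≤m x y) (≤ᵇ-false-sound {e} {x} e≤x)))
... | true  | false = sym (≤ᵇ-false-complete {e} {x ⊓ y} (≤-<-trans (m⊓n≤n x y) (≤ᵇ-false-sound {e} {y} e≤y)))

∈⇒≤max : ∀ {y ys} → y ∈ ys → y ≤ foldr _⊔_ 0 ys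
∈⇒≤max {y} (here refl)    = m≤m⊔n y _
∈⇒≤max {ys = z ∷ _} (there y∈) = ≤-trans (∈⇒≤max y∈) (m≤n⊔m z _)

max-filter-≤ : (q : ℕ → Bool) (e : ℕ) → (∀ x → q x ≡ true → x ≤ e) →
  ∀ xs → foldr _⊔_ 0 (filterᵇ q xs) ≤ e
max-filter-≤ q e h []       = z≤n
max-filter-≤ q e h (x ∷ xs) with q x in qx
... | true  = ⊔-lub (h x qx) (max-filter-≤ q e h xs)
... | false = max-filter-≤ q e h xs

∈⇒≤max-filter : (q : ℕ → Bool) (e : ℕ) → q e ≡ true → ∀ {xs} → e ∈ xs → e ≤ foldr _⊔_ 0 (filterᵇ q xs)
∈⇒≤max-filter q e qe (here refl) rewrite qe = m≤m⊔n e _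
∈⇒≤max-filter q e qe {x ∷ _} (there e∈) with q x
... | true  = ≤-trans (∈⇒≤max-filter q e qe e∈) (m≤n⊔m x _)
... | false = ∈⇒≤max-filter q e qe e∈

module _ (Γ : Graph) where
  private
    N : ℕ
    N = order Γ
    V : List (Fin N)
    V = allFin N

  degree : Fin N → ℕ
  degree v = count (adj Γ v) V

  δ≤degree : ∀ X v → δ Γ X v ≤ degree v
  δ≤degree X v = count-mono _ _ V (λ w → second (lookup X w))
    where
    second : ∀ a {b} → a ∧ b ≡ true → b ≡ true
    second true e = e

  degree≤δ₁ : ∀ v → degree v ≤ δ₁ Γ
  degree≤δ₁ v = ∈⇒≤max (∈-map⁺ degree (∈-allFin v))

  alliance-antitone : ∀ S {e e'} → e' ≤ e → isAllianceShifted Γ S e ≡ true → isAllianceShifted Γ S e' ≡ true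
  alliance-antitone S {e} {e'} e'≤e = all-mono _ _ V weaken
    where
    weaken : ∀ v → (not (lookup S v) ∨ (δ Γ (complement Γ S) v + e ≤ᵇ δ Γ S v + N)) ≡ true →
                   (not (lookup S v) ∨ (δ Γ (complement Γ S) v + e' ≤ᵇ δ Γ S v + N)) ≡ true
    weaken v p with lookup S v
    ... | false = refl
    ... | true  = ≤ᵇ-complete (≤-trans (+-monoʳ-≤ (δ Γ (complement Γ S) v) e'≤e) (≤ᵇ-sound p))

  alliance-violation : ∀ S e → isAllianceShifted Γ S e ≡ false →
    Σ (Fin N) λ v → (lookup S v ≡ true) × (δ Γ S v + N < δ Γ (complement Γ S) v + e)
  alliance-violation S e fails with all-false _ V fails
  ... | v , p = v , split (lookup S v) p
    where
    split : ∀ b → (not b ∨ (δ Γ (complement Γ S) v + e ≤ᵇ δ Γ S v + N)) ≡ false →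
      (b ≡ true) × (δ Γ S v + N < δ Γ (complement Γ S) v + e)
    split true q = refl , ≤ᵇ-false-sound q

  -- The shifted indices n + k, k ∈ [-δ₁, δ₁], are the e with n - δ₁ ≤ e ≤ n + δ₁.
  -- If S is an e-alliance but not an (e+1)-alliance, then e lies in this window.
  exact-index-in-window : ∀ S e → isAllianceShifted Γ S e ≡ true → isAllianceShifted Γ S (suc e) ≡ false →
    (N ∸ δ₁ Γ ≤ e) × (e < suc (N + δ₁ Γ))
  exact-index-in-window S e holds fails with alliance-violation S (suc e) fails
  ... | v , v∈S , violated = lower , s≤s upper
    where
    dS dC : ℕ
    dS = δ Γ S v
    dC = δ Γ (complement Γ S) v
    holds-at-v : dC + e ≤ dS + N
    holds-at-v with all-elim _ V holds (∈-allFin v)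
    ... | p rewrite v∈S = ≤ᵇ-sound p
    -- e ≤ dC + e ≤ dS + N ≤ δ₁ + N
    upper : e ≤ N + δ₁ Γ
    upper = ≤-trans (m≤n+m e dC) (≤-trans holds-at-v
              (≤-trans (+-monoˡ-≤ N (≤-trans (δ≤degree S v) (degree≤δ₁ v))) (≤-reflexive (+-comm (δ₁ Γ) N))))
    -- N ≤ dS + N ≤ dC + e ≤ δ₁ + e, using the violation at v
    lower : N ∸ δ₁ Γ ≤ e
    lower = m≤n+o⇒m∸n≤o N (δ₁ Γ) (≤-trans (m≤n+m N dS) (≤-trans (≤-pred (subst (dS + N <_) (+-suc dC e) violated))
              (+-monoˡ-≤ e (≤-trans (δ≤degree (complement Γ S) v) (degree≤δ₁ v)))))

  allianceExponent-exact : ∀ S e → isAllianceShifted Γ S e ≡ true → isAllianceShifted Γ S (suc e) ≡ false →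
    allianceExponent Γ S ≡ e
  allianceExponent-exact S e holds fails =
    ≤-antisym (max-filter-≤ admissible e below (upTo (suc (N + δ₁ Γ))))
              (∈⇒≤max-filter admissible e e-admissible (∈-upTo⁺ (proj₂ window)))
    where
    admissible : ℕ → Bool
    admissible x = (N ∸ δ₁ Γ ≤ᵇ x) ∧ isAllianceShifted Γ S x
    window : (N ∸ δ₁ Γ ≤ e) × (e < suc (N + δ₁ Γ))
    window = exact-index-in-window S e holds fails
    e-admissible : admissible e ≡ true
    e-admissible rewrite ≤ᵇ-complete (proj₁ window) = holds
    below : ∀ x → admissible x ≡ true → x ≤ e
    below x ok with x ≤? e | N ∸ δ₁ Γ ≤ᵇ x
    ... | yes x≤e | _    = x≤e
    ... | no x≰e  | true = case trans (sym (alliance-antitone S (≰⇒> x≰e) ok)) fails of λ ()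

  lookup-complement : ∀ S w → lookup (complement Γ S) w ≡ not (lookup S w)
  lookup-complement S w = lookup-map w not S

  nonempty≡size≢0 : ∀ S → nonempty Γ S ≡ not (size S ≡ᵇ 0)
  nonempty≡size≢0 S = any≡count≢0 (lookup S) V

  nonempty-by-size : ∀ S {a} → size S ≡ a → nonempty Γ S ≡ not (a ≡ᵇ 0)
  nonempty-by-size S |S|≡a = trans (nonempty≡size≢0 S) (cong (λ c → not (c ≡ᵇ 0)) |S|≡a)

  size+size-complement : ∀ S → size S + size (complement Γ S) ≡ N
  size+size-complement S = begin
    size S + size (complement Γ S)
      ≡⟨ cong (size S +_) (count-cong V (lookup-complement S)) ⟩
    size S + count (not ∘ lookup S) V
      ≡⟨ count+count-not (lookup S) V ⟩
    length V
      ≡⟨ length-tabulate id ⟩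
    N ∎

  -- The slack of v ∈ S is the c with δ_S̄(v) + c = δ_S(v) + n; S is a shifted
  -- e-alliance iff e is at most the slack of each of its vertices.
  alliance-by-slack : ∀ S (c : Fin N → ℕ) →
    (∀ v → lookup S v ≡ true → δ Γ (complement Γ S) v + c v ≡ δ Γ S v + N) →
    ∀ e → isAllianceShifted Γ S e ≡ all (λ v → not (lookup S v) ∨ (e ≤ᵇ c v)) V
  alliance-by-slack S c slack e = all-cong V test
    where
    test : ∀ v → (not (lookup S v) ∨ (δ Γ (complement Γ S) v + e ≤ᵇ δ Γ S v + N))
               ≡ (not (lookup S v) ∨ (e ≤ᵇ c v))
    test v with lookup S v in v∈S
    ... | false = refl
    ... | true  = +-≤ᵇ-cancel _ _ (c v) e (slack v v∈S)

  allianceExponent-threshold : ∀ S c → (∀ e → isAllianceShifted Γ S e ≡ (e ≤ᵇ c)) → allianceExponent Γ S ≡ c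
  allianceExponent-threshold S c test =
    allianceExponent-exact S c (trans (test c) (≤ᵇ-complete (≤-refl {c})))
                               (trans (test (suc c)) (≤ᵇ-false-complete (≤-refl {suc c})))

  allianceExponent-uniform : ∀ S c → nonempty Γ S ≡ true →
    (∀ v → lookup S v ≡ true → δ Γ (complement Γ S) v + c ≡ δ Γ S v + N) →
    allianceExponent Γ S ≡ c
  allianceExponent-uniform S c S≢∅ slack = allianceExponent-threshold S c λ e → begin
    isAllianceShifted Γ S e                        ≡⟨ alliance-by-slack S (λ _ → c) slack e ⟩
    all (λ v → not (lookup S v) ∨ (e ≤ᵇ c)) V      ≡⟨ all-guarded (lookup S) (e ≤ᵇ c) V ⟩
    not (nonempty Γ S) ∨ (e ≤ᵇ c)                  ≡⟨ cong (λ b → not b ∨ (e ≤ᵇ c)) S≢∅ ⟩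
    (e ≤ᵇ c) ∎

  reach-suc : ∀ S k u v → reach Γ S k u v ≡ true → reach Γ S (suc k) u v ≡ true
  reach-suc S k u v r rewrite r = refl

  reach-mono : ∀ S {k k'} u v → k ≤ k' → reach Γ S k u v ≡ true → reach Γ S k' u v ≡ true
  reach-mono S {k} {k'} u v k≤k' r = subst (λ l → reach Γ S l u v ≡ true) (m∸n+n≡m k≤k') (extend (k' ∸ k))
    where
    extend : ∀ d → reach Γ S (d + k) u v ≡ true
    extend zero    = r
    extend (suc d) = reach-suc S (d + k) u v (extend d)

  reach-refl : ∀ S k u → lookup S u ≡ true → reach Γ S k u u ≡ true
  reach-refl S k u u∈S = reach-mono S {k' = k} u u z≤n (cong₂ _∧_ u∈S (=ᶠ-refl u))

  reach-step : ∀ S k u w v → lookup S u ≡ true → adj Γ u w ≡ true → reach Γ S k w v ≡ true →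
    reach Γ S (suc k) u v ≡ true
  reach-step S k u w v u∈S u~w r = or-right (any-intro _ V (∈-allFin w) step)
    where
    step : (lookup S u ∧ adj Γ u w ∧ reach Γ S k w v) ≡ true
    step rewrite u∈S | u~w = r

  reach-edge : ∀ S k u v → 1 ≤ k → lookup S u ≡ true → lookup S v ≡ true → adj Γ u v ≡ true →
    reach Γ S k u v ≡ true
  reach-edge S k u v 1≤k u∈S v∈S u~v =
    reach-mono S {k' = k} u v 1≤k (reach-step S 0 u v v u∈S u~v (reach-refl S 0 v v∈S))

  reach-path2 : ∀ S k u w v → 2 ≤ k → lookup S u ≡ true → lookup S w ≡ true → lookup S v ≡ true →
    adj Γ u w ≡ true → adj Γ w v ≡ true → reach Γ S k u v ≡ true
  reach-path2 S k u w v 2≤k u∈S w∈S v∈S u~w w~v =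
    reach-mono S {k' = k} u v 2≤k (reach-step S 1 u w v u∈S u~w (reach-edge S 1 w v ≤-refl w∈S v∈S w~v))

  reach-source : ∀ S k u v → reach Γ S k u v ≡ true → lookup S u ≡ true
  reach-source S zero u v r with lookup S u
  ... | true = refl
  reach-source S (suc k) u v r with reach Γ S k u v in shorter
  ... | true  = reach-source S k u v shorter
  ... | false with any-elim _ V r
  ... | w , step with lookup S u
  ... | true = refl

  reach-independent : ∀ S → (∀ u w → lookup S u ≡ true → lookup S w ≡ true → adj Γ u w ≡ false) →
    ∀ k u v → reach Γ S k u v ≡ true → u ≡ v
  reach-independent S indep zero u v r with lookup S u
  ... | true = =ᶠ-sound u v r
  reach-independent S indep (suc k) u v r with reach Γ S k u v in shorter
  ... | true  = reach-independent S indep k u v shorter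
  ... | false with any-elim _ V r
  ... | w , step = no-edge (lookup S u) (adj Γ u w) (reach Γ S k w v) refl refl refl step
    where
    no-edge : ∀ a b c → lookup S u ≡ a → adj Γ u w ≡ b → reach Γ S k w v ≡ c → a ∧ b ∧ c ≡ true → u ≡ v
    no-edge true true true u∈S u~w r _ =
      case trans (sym u~w) (indep u w u∈S (reach-source S k w v r)) of λ ()

  connected-intro : ∀ S → (∀ u v → lookup S u ≡ true → lookup S v ≡ true → reach Γ S N u v ≡ true) →
    connected Γ S ≡ true
  connected-intro S h = all-intro _ V (λ u → all-intro _ V (pair u))
    where
    pair : ∀ u v → (not (lookup S u ∧ lookup S v) ∨ reach Γ S N u v) ≡ true
    pair u v with lookup S u in u∈S | lookup S v in v∈S
    ... | true  | true  = h u v u∈S v∈S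
    ... | true  | false = refl
    ... | false | _     = refl

  connected-elim : ∀ S u v → connected Γ S ≡ true → lookup S u ≡ true → lookup S v ≡ true →
    reach Γ S N u v ≡ true
  connected-elim S u v conn u∈S v∈S with all-elim _ V (all-elim _ V conn (∈-allFin u)) (∈-allFin v)
  ... | p rewrite u∈S | v∈S = p

  singleton-connected : ∀ S → size S ≡ 1 → connected Γ S ≡ true
  singleton-connected S |S|≡1 = connected-intro S joined
    where
    joined : ∀ u v → lookup S u ≡ true → lookup S v ≡ true → reach Γ S N u v ≡ true
    joined u v u∈S v∈S rewrite size≡1⇒unique S u v |S|≡1 u∈S v∈S = reach-refl S N v v∈S

  independent-disconnected : ∀ S → (∀ u w → lookup S u ≡ true → lookup S w ≡ true → adj Γ u w ≡ false) →
    ∀ k l → lookup S k ≡ true → lookup S l ≡ true → (k ≡ l → ⊥) → connected Γ S ≡ false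
  independent-disconnected S indep k l k∈S l∈S k≢l with connected Γ S in conn
  ... | false = refl
  ... | true  = ⊥-elim (k≢l (reach-independent S indep N k l (connected-elim S k l conn k∈S l∈S)))

module CompleteGraph (n : ℕ) where
  private
    Kn : Graph
    Kn = K n

  connected-K : ∀ S → connected Kn S ≡ true
  connected-K S = connected-intro Kn S joined
    where
    joined : ∀ u v → lookup S u ≡ true → lookup S v ≡ true → reach Kn S n u v ≡ true
    joined u v u∈S v∈S with u ≟ v
    ... | yes refl = reach-refl Kn S n u u∈S
    ... | no u≢v   = reach-edge Kn S n u v (Fin⇒1≤ u) u∈S v∈S (cong not (=ᶠ-false u v u≢v))

  -- In K_n a vertex v ∈ S with |S| = a+1 has a neighbours inside S and n - a - 1 outside,
  -- so its slack is  2a + 1 = 2|S| - 1.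
  slack-K : ∀ S a → size S ≡ suc a → ∀ v → lookup S v ≡ true →
    δ Kn (complement Kn S) v + (a + suc a) ≡ δ Kn S v + n
  slack-K S a |S|≡1+a v v∈S = begin
    δ Kn S̄ v + (a + suc a)       ≡⟨ cong (_+ (a + suc a)) outside ⟩
    size S̄ + (a + suc a)         ≡⟨ solve 2 (λ a b → b :+ (a :+ (con 1 :+ a)) := a :+ (con 1 :+ a :+ b)) refl a (size S̄) ⟩
    a + (suc a + size S̄)         ≡⟨ cong₂ _+_ inside (trans (cong (_+ size S̄) (sym |S|≡1+a)) (size+size-complement Kn S)) ⟩
    δ Kn S v + n ∎
    where
    S̄ : Subset n
    S̄ = complement Kn S
    inside : a ≡ δ Kn S v
    inside = +-cancelʳ-≡ 1 a _ (trans (+-comm a 1) (trans (sym |S|≡1+a) (sym (others+1≡size S v v∈S))))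
    outside : δ Kn S̄ v ≡ size S̄
    outside = begin
      δ Kn S̄ v                        ≡⟨ +-identityʳ _ ⟨
      δ Kn S̄ v + 𝟙 (not true)         ≡⟨ cong (λ b → δ Kn S̄ v + 𝟙 b) (trans (lookup-complement Kn S v) (cong not v∈S)) ⟨
      δ Kn S̄ v + 𝟙 (lookup S̄ v)       ≡⟨ count-except n (lookup S̄) v ⟩
      size S̄ ∎

  allianceExponent-K : ∀ S a → size S ≡ suc a → allianceExponent Kn S ≡ a + suc a
  allianceExponent-K S a |S|≡1+a =
    allianceExponent-uniform Kn S (a + suc a)
      (nonempty-by-size Kn S |S|≡1+a) (slack-K S a |S|≡1+a)

  contributes-K : ℕ → ℕ → Bool
  contributes-K i a = not (a ≡ᵇ 0) ∧ (a ∸ 1 + a ≡ᵇ i)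

  counted-K : ∀ i S → (nonempty Kn S ∧ connected Kn S ∧ (allianceExponent Kn S ≡ᵇ i)) ≡ contributes-K i (size S)
  counted-K i S with size S in |S|
  ... | zero  = cong (_∧ (connected Kn S ∧ (allianceExponent Kn S ≡ᵇ i))) (nonempty-by-size Kn S |S|)
  ... | suc a = cong₂ _∧_ (nonempty-by-size Kn S |S|)
                          (cong₂ _∧_ (connected-K S) (cong (_≡ᵇ i) (allianceExponent-K S a |S|)))

  coefficient-K : ∀ i → A Kn i ≡ monomials (suc n) (λ a → (n C a) * 𝟙 (not (a ≡ᵇ 0))) (λ a → a ∸ 1 + a) i
  coefficient-K i = begin
    A Kn i
      ≡⟨ count≡sum-𝟙 _ (allSubsets n) ⟩
    sumS n (λ S → 𝟙 (nonempty Kn S ∧ connected Kn S ∧ (allianceExponent Kn S ≡ᵇ i)))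
      ≡⟨ sumS-cong n (cong 𝟙 ∘ counted-K i) ⟩
    sumS n (𝟙 ∘ contributes-K i ∘ size)
      ≡⟨ sumS-by-size n (𝟙 ∘ contributes-K i) ⟩
    sumTo (suc n) (λ a → (n C a) * 𝟙 (contributes-K i a))
      ≡⟨ sumTo-cong (suc n) (λ a → trans (cong ((n C a) *_) (𝟙-∧ (not (a ≡ᵇ 0)) (a ∸ 1 + a ≡ᵇ i)))
                                          (sym (*-assoc (n C a) (𝟙 (not (a ≡ᵇ 0))) (𝟙 (a ∸ 1 + a ≡ᵇ i))))) ⟩
    monomials (suc n) (λ a → (n C a) * 𝟙 (not (a ≡ᵇ 0))) (λ a → a ∸ 1 + a) i ∎

tabulate-+ : ∀ n m (f : Fin (n + m) → α) → tabulate f ≡ tabulate (f ∘ (_↑ˡ m)) ++ tabulate (f ∘ (n ↑ʳ_))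
tabulate-+ zero    m f = refl
tabulate-+ (suc n) m f = cong (f zero ∷_) (tabulate-+ n m (f ∘ suc))

allFin-+ : ∀ n m → allFin (n + m) ≡ map (_↑ˡ m) (allFin n) ++ map (n ↑ʳ_) (allFin m)
allFin-+ n m = trans (tabulate-+ n m id)
                     (sym (cong₂ _++_ (map-tabulate id (_↑ˡ m)) (map-tabulate id (n ↑ʳ_))))

count-+ : ∀ n m (p : Fin (n + m) → Bool) →
  count p (allFin (n + m)) ≡ count (p ∘ (_↑ˡ m)) (allFin n) + count (p ∘ (n ↑ʳ_)) (allFin m)
count-+ n m p = begin
  count p (allFin (n + m))
    ≡⟨ cong (count p) (allFin-+ n m) ⟩
  count p (map (_↑ˡ m) (allFin n) ++ map (n ↑ʳ_) (allFin m))
    ≡⟨ count-++ p (map (_↑ˡ m) (allFin n)) (map (n ↑ʳ_) (allFin m)) ⟩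
  count p (map (_↑ˡ m) (allFin n)) + count p (map (n ↑ʳ_) (allFin m))
    ≡⟨ cong₂ _+_ (count-map p _ (allFin n)) (count-map p _ (allFin m)) ⟩
  count (p ∘ (_↑ˡ m)) (allFin n) + count (p ∘ (n ↑ʳ_)) (allFin m) ∎

all-+ : ∀ n m (p : Fin (n + m) → Bool) →
  all p (allFin (n + m)) ≡ all (p ∘ (_↑ˡ m)) (allFin n) ∧ all (p ∘ (n ↑ʳ_)) (allFin m)
all-+ n m p = begin
  all p (allFin (n + m))
    ≡⟨ cong (all p) (allFin-+ n m) ⟩
  all p (map (_↑ˡ m) (allFin n) ++ map (n ↑ʳ_) (allFin m))
    ≡⟨ all-++ p (map (_↑ˡ m) (allFin n)) (map (n ↑ʳ_) (allFin m)) ⟩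
  all p (map (_↑ˡ m) (allFin n)) ∧ all p (map (n ↑ʳ_) (allFin m))
    ≡⟨ cong₂ _∧_ (all-map p _ (allFin n)) (all-map p _ (allFin m)) ⟩
  all (p ∘ (_↑ˡ m)) (allFin n) ∧ all (p ∘ (n ↑ʳ_)) (allFin m) ∎

data Side (n m : ℕ) : Fin (n + m) → Set where
  left  : (i : Fin n) → Side n m (i ↑ˡ m)
  right : (k : Fin m) → Side n m (n ↑ʳ k)

side : ∀ n m (u : Fin (n + m)) → Side n m u
side n m u with splitAt n u | join-splitAt n m u
... | inj₁ i | refl = left i
... | inj₂ k | refl = right k

module Join (n m : ℕ) where
  J : Graph
  J = join (K n) (Kbar m)

  adj-left-left : ∀ i k → adj J (i ↑ˡ m) (k ↑ˡ m) ≡ not (i =ᶠ k)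
  adj-left-left i k rewrite splitAt-↑ˡ n i m | splitAt-↑ˡ n k m = refl

  adj-left-right : ∀ i k → adj J (i ↑ˡ m) (n ↑ʳ k) ≡ true
  adj-left-right i k rewrite splitAt-↑ˡ n i m | splitAt-↑ʳ n m k = refl

  adj-right-left : ∀ k i → adj J (n ↑ʳ k) (i ↑ˡ m) ≡ true
  adj-right-left k i rewrite splitAt-↑ˡ n i m | splitAt-↑ʳ n m k = refl

  adj-right-right : ∀ k l → adj J (n ↑ʳ k) (n ↑ʳ l) ≡ false
  adj-right-right k l rewrite splitAt-↑ʳ n m k | splitAt-↑ʳ n m l = refl

  size-++ : ∀ (S₁ : Subset n) (S₂ : Subset m) → size (S₁ ++ᵛ S₂) ≡ size S₁ + size S₂
  size-++ S₁ S₂ = trans (count-+ n m (lookup (S₁ ++ᵛ S₂)))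
    (cong₂ _+_ (count-cong (allFin n) (lookup-++ˡ S₁ S₂)) (count-cong (allFin m) (lookup-++ʳ S₁ S₂)))

  complement-++ : ∀ (S₁ : Subset n) (S₂ : Subset m) →
    complement J (S₁ ++ᵛ S₂) ≡ complement (K n) S₁ ++ᵛ complement (Kbar m) S₂
  complement-++ S₁ S₂ = map-++ᵛ not S₁ S₂

  δ-left : ∀ (X₁ : Subset n) (X₂ : Subset m) i → δ J (X₁ ++ᵛ X₂) (i ↑ˡ m) ≡ δ (K n) X₁ i + size X₂
  δ-left X₁ X₂ i = trans (count-+ n m _)
    (cong₂ _+_ (count-cong (allFin n) (λ k → cong₂ _∧_ (lookup-++ˡ X₁ X₂ k) (adj-left-left i k)))
               (count-cong (allFin m) (λ k → trans (cong₂ _∧_ (lookup-++ʳ X₁ X₂ k) (adj-left-right i k))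
                                                   (∧-identityʳ (lookup X₂ k)))))

  δ-right : ∀ (X₁ : Subset n) (X₂ : Subset m) l → δ J (X₁ ++ᵛ X₂) (n ↑ʳ l) ≡ size X₁
  δ-right X₁ X₂ l = trans (count-+ n m _) (trans
    (cong₂ _+_ (count-cong (allFin n) (λ k → trans (cong₂ _∧_ (lookup-++ˡ X₁ X₂ k) (adj-right-left l k))
                                                   (∧-identityʳ (lookup X₁ k))))
               (count-false _ (allFin m) (λ k → trans (cong (lookup (X₁ ++ᵛ X₂) (n ↑ʳ k) ∧_) (adj-right-right l k))
                                                      (∧-zeroʳ _))))
    (+-identityʳ (size X₁)))

  -- The contribution to [x^j] A(J; x) of a connected S = S₁ ∪ S₂ with |S₁| = a, |S₂| = r:
  -- either S is a single vertex of K̄_m (exponent m), or S meets K_n (exponent 2a - 1 + min(2r, m + 1)).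
  contributes-J : ℕ → ℕ → ℕ → Bool
  contributes-J j zero    r = (r ≡ᵇ 1) ∧ (m ≡ᵇ j)
  contributes-J j (suc a) r = (a + suc a) + (2 * r) ⊓ (m + 1) ≡ᵇ j

  module _ (S₁ : Subset n) (S₂ : Subset m) where
    private
      S S̄ : Subset (n + m)
      S  = S₁ ++ᵛ S₂
      S̄  = complement J S
      S̄₁ : Subset n
      S̄₁ = complement (K n) S₁
      S̄₂ : Subset m
      S̄₂ = complement (Kbar m) S₂
      a r : ℕ
      a  = size S₁
      r  = size S₂

    slackₗ slackᵣ : ℕ
    slackₗ = (a ∸ 1 + a) + 2 * r
    slackᵣ = a + a + m

    -- For i ∈ S₁ this reduces to the slack 2a - 1 of i in K_n, plus the r + (m - r) vertices of K̄_m.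
    slackₗ-correct : ∀ i → lookup S₁ i ≡ true → δ J S̄ (i ↑ˡ m) + slackₗ ≡ δ J S (i ↑ˡ m) + (n + m)
    slackₗ-correct i i∈S₁ = begin
      δ J S̄ (i ↑ˡ m) + slackₗ
        ≡⟨ cong (λ X → δ J X (i ↑ˡ m) + slackₗ) (complement-++ S₁ S₂) ⟩
      δ J (S̄₁ ++ᵛ S̄₂) (i ↑ˡ m) + slackₗ
        ≡⟨ cong (_+ slackₗ) (δ-left S̄₁ S̄₂ i) ⟩
      δ (K n) S̄₁ i + size S̄₂ + ((a ∸ 1 + a) + 2 * r)
        ≡⟨ cong (λ x → δ (K n) S̄₁ i + size S̄₂ + ((x ∸ 1 + x) + 2 * r)) (sym |S₁|≡1+a') ⟩
      δ (K n) S̄₁ i + size S̄₂ + ((a' + suc a') + 2 * r)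
        ≡⟨ solve 4 (λ d s c r → d :+ s :+ (c :+ con 2 :* r) := d :+ c :+ (s :+ con 2 :* r)) refl
                   (δ (K n) S̄₁ i) (size S̄₂) (a' + suc a') r ⟩
      δ (K n) S̄₁ i + (a' + suc a') + (size S̄₂ + 2 * r)
        ≡⟨ cong (_+ (size S̄₂ + 2 * r)) (CompleteGraph.slack-K n S₁ a' (sym |S₁|≡1+a') i i∈S₁) ⟩
      δ (K n) S₁ i + n + (size S̄₂ + 2 * r)
        ≡⟨ solve 4 (λ d n s r → d :+ n :+ (s :+ con 2 :* r) := d :+ r :+ (n :+ (r :+ s))) refl
                   (δ (K n) S₁ i) n (size S̄₂) r ⟩
      δ (K n) S₁ i + r + (n + (r + size S̄₂))
        ≡⟨ cong₂ (λ x y → x + (n + y)) (sym (δ-left S₁ S₂ i)) (size+size-complement (Kbar m) S₂) ⟩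
      δ J S (i ↑ˡ m) + (n + m) ∎
      where
      a' : ℕ
      a' = others S₁ i
      |S₁|≡1+a' : suc a' ≡ a
      |S₁|≡1+a' = trans (+-comm 1 a') (others+1≡size S₁ i i∈S₁)

    -- A vertex of K̄_m has a neighbours in S and n - a outside.
    slackᵣ-correct : ∀ l → δ J S̄ (n ↑ʳ l) + slackᵣ ≡ δ J S (n ↑ʳ l) + (n + m)
    slackᵣ-correct l = begin
      δ J S̄ (n ↑ʳ l) + slackᵣ
        ≡⟨ cong (λ X → δ J X (n ↑ʳ l) + slackᵣ) (complement-++ S₁ S₂) ⟩
      δ J (S̄₁ ++ᵛ S̄₂) (n ↑ʳ l) + slackᵣ
        ≡⟨ cong (_+ slackᵣ) (δ-right S̄₁ S̄₂ l) ⟩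
      size S̄₁ + (a + a + m)
        ≡⟨ solve 3 (λ s a m → s :+ (a :+ a :+ m) := a :+ ((a :+ s) :+ m)) refl (size S̄₁) a m ⟩
      a + ((a + size S̄₁) + m)
        ≡⟨ cong₂ (λ x y → x + (y + m)) (sym (δ-right S₁ S₂ l)) (size+size-complement (K n) S₁) ⟩
      δ J S (n ↑ʳ l) + (n + m) ∎

    slack : Fin (n + m) → ℕ
    slack v = [ (λ _ → slackₗ) , (λ _ → slackᵣ) ]′ (splitAt n v)

    slack-left : ∀ i → slack (i ↑ˡ m) ≡ slackₗ
    slack-left i = cong [ (λ _ → slackₗ) , (λ _ → slackᵣ) ]′ (splitAt-↑ˡ n i m)

    slack-right : ∀ l → slack (n ↑ʳ l) ≡ slackᵣ
    slack-right l = cong [ (λ _ → slackₗ) , (λ _ → slackᵣ) ]′ (splitAt-↑ʳ n m l)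

    slack-correct : ∀ v → lookup S v ≡ true → δ J S̄ v + slack v ≡ δ J S v + (n + m)
    slack-correct v v∈S with side n m v
    ... | left i  rewrite slack-left i  = slackₗ-correct i (trans (sym (lookup-++ˡ S₁ S₂ i)) v∈S)
    ... | right l rewrite slack-right l = slackᵣ-correct l

    alliance-J : ∀ e → isAllianceShifted J S e
      ≡ (not (any (lookup S₁) (allFin n)) ∨ (e ≤ᵇ slackₗ)) ∧ (not (any (lookup S₂) (allFin m)) ∨ (e ≤ᵇ slackᵣ))
    alliance-J e = begin
      isAllianceShifted J S e
        ≡⟨ alliance-by-slack J S slack slack-correct e ⟩
      all test (allFin (n + m))
        ≡⟨ all-+ n m test ⟩
      all (test ∘ (_↑ˡ m)) (allFin n) ∧ all (test ∘ (n ↑ʳ_)) (allFin m)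
        ≡⟨ cong₂ _∧_ (all-cong (allFin n) (λ i → cong₂ (λ b x → not b ∨ (e ≤ᵇ x)) (lookup-++ˡ S₁ S₂ i) (slack-left i)))
                     (all-cong (allFin m) (λ l → cong₂ (λ b x → not b ∨ (e ≤ᵇ x)) (lookup-++ʳ S₁ S₂ l) (slack-right l))) ⟩
      all (λ i → not (lookup S₁ i) ∨ (e ≤ᵇ slackₗ)) (allFin n) ∧ all (λ l → not (lookup S₂ l) ∨ (e ≤ᵇ slackᵣ)) (allFin m)
        ≡⟨ cong₂ _∧_ (all-guarded (lookup S₁) (e ≤ᵇ slackₗ) (allFin n)) (all-guarded (lookup S₂) (e ≤ᵇ slackᵣ) (allFin m)) ⟩
      (not (any (lookup S₁) (allFin n)) ∨ (e ≤ᵇ slackₗ)) ∧ (not (any (lookup S₂) (allFin m)) ∨ (e ≤ᵇ slackᵣ)) ∎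
      where
      test : Fin (n + m) → Bool
      test v = not (lookup S v) ∨ (e ≤ᵇ slack v)

    any-S₁ : any (lookup S₁) (allFin n) ≡ not (a ≡ᵇ 0)
    any-S₁ = any≡count≢0 (lookup S₁) (allFin n)

    any-S₂ : any (lookup S₂) (allFin m) ≡ not (r ≡ᵇ 0)
    any-S₂ = any≡count≢0 (lookup S₂) (allFin m)

    -- If S meets K_n, with |S₁| = a' + 1, then n + m + k_S = 2a' + 1 + min(2r, m + 1):
    -- the binding constraint is slackₗ if S₂ = ∅, and min(slackₗ, slackᵣ) otherwise.
    exponent-meeting-K : ∀ a' → a ≡ suc a' → allianceExponent J S ≡ (a' + suc a') + (2 * r) ⊓ (m + 1)
    exponent-meeting-K a' |S₁|≡1+a' = allianceExponent-threshold J S _ (λ e → trans (alliance-J e) (test e))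
      where
      c : ℕ
      c = a' + suc a'
      left-test : ∀ e → (not (any (lookup S₁) (allFin n)) ∨ (e ≤ᵇ slackₗ)) ≡ (e ≤ᵇ c + 2 * r)
      left-test e = cong₂ (λ b x → not b ∨ (e ≤ᵇ (x ∸ 1 + x) + 2 * r))
                          (trans any-S₁ (cong (λ x → not (x ≡ᵇ 0)) |S₁|≡1+a')) |S₁|≡1+a'
      slackᵣ≡ : slackᵣ ≡ c + (m + 1)
      slackᵣ≡ = trans (cong (λ x → x + x + m) |S₁|≡1+a')
                      (solve 2 (λ a m → con 1 :+ a :+ (con 1 :+ a) :+ m := a :+ (con 1 :+ a) :+ (m :+ con 1)) refl a' m)
      test : ∀ e → (not (any (lookup S₁) (allFin n)) ∨ (e ≤ᵇ slackₗ)) ∧ (not (any (lookup S₂) (allFin m)) ∨ (e ≤ᵇ slackᵣ))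
                   ≡ (e ≤ᵇ c + (2 * r) ⊓ (m + 1))
      test e = by-size-of-S₂ r refl
        where
        by-size-of-S₂ : ∀ k → r ≡ k →
          (not (any (lookup S₁) (allFin n)) ∨ (e ≤ᵇ slackₗ)) ∧ (not (any (lookup S₂) (allFin m)) ∨ (e ≤ᵇ slackᵣ))
            ≡ (e ≤ᵇ c + (2 * r) ⊓ (m + 1))
        by-size-of-S₂ zero |S₂|≡0 = begin
          (not (any (lookup S₁) (allFin n)) ∨ (e ≤ᵇ slackₗ)) ∧ (not (any (lookup S₂) (allFin m)) ∨ (e ≤ᵇ slackᵣ))
            ≡⟨ cong₂ _∧_ (left-test e) (cong (λ b → not b ∨ (e ≤ᵇ slackᵣ)) (trans any-S₂ (cong (λ x → not (x ≡ᵇ 0)) |S₂|≡0))) ⟩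
          (e ≤ᵇ c + 2 * r) ∧ true
            ≡⟨ ∧-identityʳ _ ⟩
          (e ≤ᵇ c + 2 * r)
            ≡⟨ cong (λ x → e ≤ᵇ c + x) (trans (cong (2 *_) |S₂|≡0) (sym (cong (λ x → (2 * x) ⊓ (m + 1)) |S₂|≡0))) ⟩
          (e ≤ᵇ c + (2 * r) ⊓ (m + 1)) ∎
        by-size-of-S₂ (suc _) |S₂|≢0 = begin
          (not (any (lookup S₁) (allFin n)) ∨ (e ≤ᵇ slackₗ)) ∧ (not (any (lookup S₂) (allFin m)) ∨ (e ≤ᵇ slackᵣ))
            ≡⟨ cong₂ _∧_ (left-test e) (cong₂ (λ b x → not b ∨ (e ≤ᵇ x)) (trans any-S₂ (cong (λ x → not (x ≡ᵇ 0)) |S₂|≢0)) slackᵣ≡) ⟩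
          (e ≤ᵇ c + 2 * r) ∧ (e ≤ᵇ c + (m + 1))
            ≡⟨ ≤ᵇ-⊓ e (c + 2 * r) (c + (m + 1)) ⟩
          (e ≤ᵇ (c + 2 * r) ⊓ (c + (m + 1)))
            ≡⟨ cong (e ≤ᵇ_) (sym (+-distribˡ-⊓ c (2 * r) (m + 1))) ⟩
          (e ≤ᵇ c + (2 * r) ⊓ (m + 1)) ∎

    -- If S meets K_n, any two vertices of S are adjacent or have a common neighbour in S₁.
    connected-meeting-K : ∀ a' → a ≡ suc a' → connected J S ≡ true
    connected-meeting-K a' |S₁|≡1+a' with size≢0⇒member S₁ |S₁|≡1+a'
    ... | i₀ , i₀∈S₁ = connected-intro J S joined
      where
      hub∈S : lookup S (i₀ ↑ˡ m) ≡ true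
      hub∈S = trans (lookup-++ˡ S₁ S₂ i₀) i₀∈S₁
      joined : ∀ u v → lookup S u ≡ true → lookup S v ≡ true → reach J S (n + m) u v ≡ true
      joined u v u∈S v∈S with side n m u | side n m v
      ... | left i | left k with i ≟ k
      ...   | yes refl = reach-refl J S (n + m) _ u∈S
      ...   | no i≢k   = reach-edge J S (n + m) _ _ (Fin⇒1≤ u) u∈S v∈S
                                    (trans (adj-left-left i k) (cong not (=ᶠ-false i k i≢k)))
      joined u v u∈S v∈S | left i  | right l = reach-edge J S (n + m) _ _ (Fin⇒1≤ u) u∈S v∈S (adj-left-right i l)
      joined u v u∈S v∈S | right k | left i  = reach-edge J S (n + m) _ _ (Fin⇒1≤ u) u∈S v∈S (adj-right-left k i)
      joined u v u∈S v∈S | right k | right l =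
        reach-path2 J S (n + m) _ (i₀ ↑ˡ m) _ (+-mono-≤ (Fin⇒1≤ i₀) (Fin⇒1≤ k)) u∈S hub∈S v∈S
                    (adj-right-left k i₀) (adj-left-right i₀ l)

    not-in-K : a ≡ 0 → ∀ i → lookup S (i ↑ˡ m) ≡ true → ⊥
    not-in-K |S₁|≡0 i i∈S = case trans (sym (size≡0⇒∉ S₁ i |S₁|≡0)) (trans (sym (lookup-++ˡ S₁ S₂ i)) i∈S) of λ ()

    independent-avoiding-K : a ≡ 0 → ∀ u w → lookup S u ≡ true → lookup S w ≡ true → adj J u w ≡ false
    independent-avoiding-K |S₁|≡0 u w u∈S w∈S with side n m u | side n m w
    ... | left i  | _       = ⊥-elim (not-in-K |S₁|≡0 i u∈S)
    ... | right k | left i  = ⊥-elim (not-in-K |S₁|≡0 i w∈S)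
    ... | right k | right l = adj-right-right k l

    -- A single vertex of K̄_m has exactly its n neighbours outside, so n + m + k_S = m.
    exponent-single-vertex : a ≡ 0 → r ≡ 1 → allianceExponent J S ≡ m
    exponent-single-vertex |S₁|≡0 |S₂|≡1 = allianceExponent-threshold J S m λ e → begin
      isAllianceShifted J S e
        ≡⟨ alliance-J e ⟩
      (not (any (lookup S₁) (allFin n)) ∨ (e ≤ᵇ slackₗ)) ∧ (not (any (lookup S₂) (allFin m)) ∨ (e ≤ᵇ slackᵣ))
        ≡⟨ cong₂ (λ b₁ b₂ → (not b₁ ∨ (e ≤ᵇ slackₗ)) ∧ (not b₂ ∨ (e ≤ᵇ slackᵣ)))
                 (trans any-S₁ (cong (λ x → not (x ≡ᵇ 0)) |S₁|≡0)) (trans any-S₂ (cong (λ x → not (x ≡ᵇ 0)) |S₂|≡1)) ⟩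
      (e ≤ᵇ slackᵣ)
        ≡⟨ cong (λ x → e ≤ᵇ x + x + m) |S₁|≡0 ⟩
      (e ≤ᵇ m) ∎

    counted-J : ∀ j → (nonempty J S ∧ connected J S ∧ (allianceExponent J S ≡ᵇ j)) ≡ contributes-J j a r
    counted-J j = by-sizes a r refl refl
      where
      size-S : ∀ {a₀ r₀} → a ≡ a₀ → r ≡ r₀ → size S ≡ a₀ + r₀
      size-S |S₁| |S₂| = trans (size-++ S₁ S₂) (cong₂ _+_ |S₁| |S₂|)
      nonempty-sizes : ∀ {a₀ r₀} → a ≡ a₀ → r ≡ r₀ → nonempty J S ≡ not (a₀ + r₀ ≡ᵇ 0)
      nonempty-sizes |S₁| |S₂| = nonempty-by-size J S (size-S |S₁| |S₂|)
      by-sizes : ∀ a₀ r₀ → a ≡ a₀ → r ≡ r₀ →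
        (nonempty J S ∧ connected J S ∧ (allianceExponent J S ≡ᵇ j)) ≡ contributes-J j a₀ r₀
      by-sizes (suc a') r₀ |S₁| |S₂| =
        cong₂ _∧_ (nonempty-sizes |S₁| |S₂|)
                  (cong₂ _∧_ (connected-meeting-K a' |S₁|)
                             (cong (_≡ᵇ j) (trans (exponent-meeting-K a' |S₁|)
                                                  (cong (λ x → (a' + suc a') + (2 * x) ⊓ (m + 1)) |S₂|))))
      by-sizes zero zero |S₁| |S₂| =
        cong (_∧ (connected J S ∧ (allianceExponent J S ≡ᵇ j))) (nonempty-sizes |S₁| |S₂|)
      by-sizes zero (suc zero) |S₁| |S₂| =
        cong₂ _∧_ (nonempty-sizes |S₁| |S₂|)
                  (cong₂ _∧_ (singleton-connected J S (size-S |S₁| |S₂|))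
                             (cong (_≡ᵇ j) (exponent-single-vertex |S₁| |S₂|)))
      by-sizes zero (suc (suc r')) |S₁| |S₂|
        with size≥2⇒distinct S (size-S |S₁| |S₂|)
      ... | k , l , k∈S , l∈S , k≢l =
        trans (cong (λ b → nonempty J S ∧ (b ∧ (allianceExponent J S ≡ᵇ j)))
                    (independent-disconnected J S (independent-avoiding-K |S₁|) k l k∈S l∈S k≢l))
              (∧-zeroʳ (nonempty J S))

  coefficient-J : ∀ j → A J j ≡ sumTo (suc n) (λ a → (n C a) * sumTo (suc m) (λ r → (m C r) * 𝟙 (contributes-J j a r)))
  coefficient-J j = begin
    A J j
      ≡⟨ count≡sum-𝟙 _ (allSubsets (n + m)) ⟩
    sumS (n + m) (λ S → 𝟙 (nonempty J S ∧ connected J S ∧ (allianceExponent J S ≡ᵇ j)))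
      ≡⟨ sumS-++ n m _ ⟩
    sumS n (λ S₁ → sumS m (λ S₂ → 𝟙 (nonempty J (S₁ ++ᵛ S₂) ∧ connected J (S₁ ++ᵛ S₂) ∧ (allianceExponent J (S₁ ++ᵛ S₂) ≡ᵇ j))))
      ≡⟨ sumS-cong n (λ S₁ → sumS-cong m (λ S₂ → cong 𝟙 (counted-J S₁ S₂ j))) ⟩
    sumS n (λ S₁ → sumS m (λ S₂ → 𝟙 (contributes-J j (size S₁) (size S₂))))
      ≡⟨ sumS-cong n (λ S₁ → sumS-by-size m (λ r → 𝟙 (contributes-J j (size S₁) r))) ⟩
    sumS n (λ S₁ → sumTo (suc m) (λ r → (m C r) * 𝟙 (contributes-J j (size S₁) r)))
      ≡⟨ sumS-by-size n (λ a → sumTo (suc m) (λ r → (m C r) * 𝟙 (contributes-J j a r))) ⟩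
    sumTo (suc n) (λ a → (n C a) * sumTo (suc m) (λ r → (m C r) * 𝟙 (contributes-J j a r))) ∎

Ã-monomials : ∀ m k → Ã m k ≡ monomials (suc m) (m C_) (λ r → (2 * r) ⊓ (m + 1)) k
Ã-monomials m k = trans (sum-upTo (suc m) (λ r → monomial (m C r) ((2 * r) ⊓ (m + 1)) k))
                        (sumTo-cong (suc m) (λ r → monomial≡𝟙 (m C r) ((2 * r) ⊓ (m + 1)) k))

singletons : ∀ m b → sumTo (suc m) (λ r → (m C r) * 𝟙 ((r ≡ᵇ 1) ∧ b)) ≡ m * 𝟙 b
singletons zero     b = refl
singletons (suc m') b = begin
  (suc m' C 1) * 𝟙 b + sumTo m' (λ r → (suc m' C suc (suc r)) * 0)
    ≡⟨ cong₂ _+_ (cong (_* 𝟙 b) (nC1≡n (suc m'))) (sumTo-zero m' _ (λ r → *-zeroʳ (suc m' C suc (suc r)))) ⟩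
  suc m' * 𝟙 b + 0
    ≡⟨ +-identityʳ _ ⟩
  suc m' * 𝟙 b ∎

-- Split the sets S = S₁ ∪ S₂ counted in A(J; x) by whether S₁ = ∅: the sets with S₁ ≠ ∅
-- give the product A(K_n; x) Ã_m(x), the singletons of K̄_m give m x^m.
A-join : ∀ n m j → A (join (K n) (Kbar m)) j ≡ ((A (K n) ⊛ Ã m) ⊕ monomial m m) j
A-join n m j = begin
  A (join (K n) (Kbar m)) j
    ≡⟨ Join.coefficient-J n m j ⟩
  (n C 0) * single + meeting-K
    ≡⟨ +-comm ((n C 0) * single) meeting-K ⟩
  meeting-K + (n C 0) * single
    ≡⟨ cong₂ _+_ (sym product) (trans (*-identityˡ single) (trans (singletons m (m ≡ᵇ j)) (sym (monomial≡𝟙 m m j)))) ⟩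
  (A (K n) ⊛ Ã m) j + monomial m m j ∎
  where
  d : ℕ → ℕ
  d r = (2 * r) ⊓ (m + 1)
  single meeting-K : ℕ
  single    = sumTo (suc m) (λ r → (m C r) * 𝟙 ((r ≡ᵇ 1) ∧ (m ≡ᵇ j)))
  meeting-K = sumTo n (λ a → (n C suc a) * sumTo (suc m) (λ r → (m C r) * 𝟙 ((a + suc a) + d r ≡ᵇ j)))
  product : (A (K n) ⊛ Ã m) j ≡ meeting-K
  product = begin
    (A (K n) ⊛ Ã m) j
      ≡⟨ ⊛-cong (CompleteGraph.coefficient-K n) (Ã-monomials m) j ⟩
    (monomials (suc n) (λ a → (n C a) * 𝟙 (not (a ≡ᵇ 0))) (λ a → a ∸ 1 + a) ⊛ monomials (suc m) (m C_) d) j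
      ≡⟨ ⊛-monomials (suc n) (λ a → (n C a) * 𝟙 (not (a ≡ᵇ 0))) (λ a → a ∸ 1 + a) (suc m) (m C_) d j ⟩
    sumTo n (λ a → ((n C suc a) * 1) * sumTo (suc m) (λ r → (m C r) * 𝟙 ((a + suc a) + d r ≡ᵇ j)))
      ≡⟨ sumTo-cong n (λ a → cong (_* sumTo (suc m) (λ r → (m C r) * 𝟙 ((a + suc a) + d r ≡ᵇ j))) (*-identityʳ (n C suc a))) ⟩
    meeting-K ∎

theorem2p13 : (n m : ℕ) → n ≥ 1 → m ≥ 1 →
    ∀ j → A (join (K n) (Kbar m)) j ≡ ((A (K n) ⊛ Ã m) ⊕ monomial m m) j
theorem2p13 n m _ _ = A-join n m
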